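{- Let $L$ be a complete lattice with unary operations $\neg,\Box,\Diamond$ such that $\neg$ is dually self-adjoint with $\neg1=0$, $\Box$ is completely multiplicative, $\Diamond$ is completely additive, and $\Diamond\neg a\leq\neg\Box a$ for all $a\in L$. Define $X=\{(a,b)\mid a,b\in L,\ \neg a\leq b\}$, writing $x_0=a$, $x_1=b$ for $x=(a,b)$; $x\vartriangleleft y$ iff $y_0\not\leq x_1$; $xRy$ iff for all $a\in L$ both ($x_0\leq\Box a\Rightarrow y_0\leq a$) and ($\Diamond a\leq x_1\Rightarrow a\leq y_1$); and $Q=R$. Then: (1) $\mathcal{F}=(X,\vartriangleleft,R,Q)$ is a unified, additive modal frame with $\vartriangleleft$ pseudo-symmetric; (2) $(L,\neg,\Box,\Diamond)$ is isomorphic to $(\mathfrak{L}(X,\vartriangleleft),\neg_\vartriangleleft,\Box_R,\Diamond_Q)$; (3) if $a\wedge\neg a=0$ for all $a\in L$, then $\vartriangleleft$ is pseudo-reflexive; (4) if $\neg\Diamond a\leq\Box\neg a$ for all $a\in L$, then $\mathcal{F}$ is negative.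
   Context: Dually self-adjoint: $a\leq\neg b$ implies $b\leq\neg a$. Completely multiplicative/additive: $\Box$ preserves all meets, $\Diamond$ preserves all joins. A modal frame is $(X,\vartriangleleft,R,Q)$ with $X$ nonempty and binary relations such that for all $x,y,z$: if $xRy$ and $z\vartriangleleft y$, then there is $x'\vartriangleleft x$ such that for all $x''$ with $x'\vartriangleleft x''$ there is $y''$ with $x''Ry''$ and $z\vartriangleleft y''$. It is unified if $R=Q$; additive if for all $x,y,z$: if $xQy$ and $y\vartriangleleft z$ then there is $x'$ with $x\vartriangleleft x'$ such that for all $x''\vartriangleleft x'$ there is $y''$ with $x''Qy''$ and $y''\vartriangleleft z$; negative if for all $x,y,z$: if $xRy$ and $z\vartriangleleft y$ then there is $x'\vartriangleleft x$ such that for all $x''\vartriangleleft x'$ there is $y''$ with $x''Qy''$ and $y''\vartriangleleft z$. Say $z$ pre-refines $x$ if every $w\vartriangleleft z$ satisfies $w\vartriangleleft x$; $x$ is non-absurd if some $y\vartriangleleft x$. $\vartriangleleft$ is pseudo-reflexive if every non-absurd $x$ has some $z\vartriangleleft x$ that pre-refines $x$; pseudo-symmetric if for all $x$ and $y\vartriangleleft x$ there is $z\vartriangleleft y$ that pre-refines $x$. ($u\vartriangleright v$ means $v\vartriangleleft u$.) $c_\vartriangleleft(A)=\{x\mid \forall y\vartriangleleft x\ \exists z\vartriangleright y: z\in A\}$; $\mathfrak{L}(X,\vartriangleleft)$ is the complete lattice of its fixpoints (meet = intersection, join = $c_\vartriangleleft$ of union). $\neg_\vartriangleleft A=\{x\mid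 \forall y\vartriangleleft x,\ y\notin A\}$; $\Box_RA=\{x\mid \forall y(xRy\Rightarrow y\in A)\}$; $\Diamond_QA=\{x\mid \forall x'\vartriangleleft x\ \exists y'\,(x'Qy')\ \exists y\vartriangleright y': y\in A\}$. -}

module Defs where

open import Level using (Level; Lift; suc)
open import Data.Empty using (⊥)
open import Data.Product using (Σ; ∃; ∃-syntax; _×_; _,_; proj₁; proj₂)
open import Data.Sum using (_⊎_)
open import Relation.Nullary using (¬_)
open import Relation.Binary using (Rel; IsPartialOrder)
open import Relation.Binary.PropositionalEquality using (_≡_)
open import Relation.Unary using (Pred; _⊆_; _≐_)

record CompleteLattice (ℓ : Level) : Set (suc ℓ) where
  field
    Carrier        : Set ℓ
    _≤_            : Rel Carrier ℓ
    isPartialOrder : IsPartialOrder _≡_ _≤_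
    ⋁              : Pred Carrier ℓ → Carrier
    ⋀              : Pred Carrier ℓ → Carrier
    ⋁-upper        : ∀ (S : Pred Carrier ℓ) x → S x → x ≤ ⋁ S
    ⋁-least        : ∀ (S : Pred Carrier ℓ) y → (∀ x → S x → x ≤ y) → ⋁ S ≤ y
    ⋀-lower        : ∀ (S : Pred Carrier ℓ) x → S x → ⋀ S ≤ x
    ⋀-greatest     : ∀ (S : Pred Carrier ℓ) y → (∀ x → S x → y ≤ x) → y ≤ ⋀ S

  𝟙 : Carrier
  𝟙 = ⋀ (λ _ → Lift ℓ ⊥)

  𝟘 : Carrier
  𝟘 = ⋁ (λ _ → Lift ℓ ⊥)

  _∧_ : Carrier → Carrier → Carrier
  a ∧ b = ⋀ (λ x → x ≡ a ⊎ x ≡ b)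

  Img : (Carrier → Carrier) → Pred Carrier ℓ → Pred Carrier ℓ
  Img f S y = ∃[ x ] (S x × y ≡ f x)

ExcludedMiddle : (ℓ : Level) → Set (suc ℓ)
ExcludedMiddle ℓ = (P : Set ℓ) → P ⊎ ¬ P

module LatticeOps {ℓ} (L : CompleteLattice ℓ) where
  open CompleteLattice L

  DuallySelfAdjoint : (Carrier → Carrier) → Set ℓ
  DuallySelfAdjoint neg = ∀ a b → a ≤ neg b → b ≤ neg a

  CompletelyMultiplicative : (Carrier → Carrier) → Set (suc ℓ)
  CompletelyMultiplicative box = ∀ (S : Pred Carrier ℓ) → box (⋀ S) ≡ ⋀ (Img box S)

  CompletelyAdditive : (Carrier → Carrier) → Set (suc ℓ)
  CompletelyAdditive dia = ∀ (S : Pred Carrier ℓ) → dia (⋁ S) ≡ ⋁ (Img dia S)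

module FrameDefs {ℓ} {X : Set ℓ} (_◁_ : Rel X ℓ) where

  record IsModalFrame (R Q : Rel X ℓ) : Set ℓ where
    field
      nonempty : X
      frame    : ∀ x y z → R x y → z ◁ y →
                 ∃[ x′ ] (x′ ◁ x × (∀ x″ → x′ ◁ x″ → ∃[ y″ ] (R x″ y″ × z ◁ y″)))

  Unified : (R Q : Rel X ℓ) → Set ℓ
  Unified R Q = ∀ x y → (R x y → Q x y) × (Q x y → R x y)

  Additive : (R Q : Rel X ℓ) → Set ℓ
  Additive R Q = ∀ x y z → Q x y → y ◁ z →
    ∃[ x′ ] (x ◁ x′ × (∀ x″ → x″ ◁ x′ → ∃[ y″ ] (Q x″ y″ × y″ ◁ z)))

  Negative : (R Q : Rel X ℓ) → Set ℓ
  Negative R Q = ∀ x y z → R x y → z ◁ y →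
    ∃[ x′ ] (x′ ◁ x × (∀ x″ → x″ ◁ x′ → ∃[ y″ ] (Q x″ y″ × y″ ◁ z)))

  PreRefines : X → X → Set ℓ
  PreRefines z x = ∀ w → w ◁ z → w ◁ x

  NonAbsurd : X → Set ℓ
  NonAbsurd x = ∃[ y ] (y ◁ x)

  PseudoReflexive : Set ℓ
  PseudoReflexive = ∀ x → NonAbsurd x → ∃[ z ] (z ◁ x × PreRefines z x)

  PseudoSymmetric : Set ℓ
  PseudoSymmetric = ∀ x y → y ◁ x → ∃[ z ] (z ◁ y × PreRefines z x)

  -- closure operator c_◁ and its fixpoints (the elements of 𝔏(X,◁))
  c◁ : Pred X ℓ → Pred X ℓ
  c◁ A x = ∀ y → y ◁ x → ∃[ z ] (y ◁ z × A z)

  IsFixpoint : Pred X ℓ → Set ℓ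
  IsFixpoint A = c◁ A ≐ A

  neg◁ : Pred X ℓ → Pred X ℓ
  neg◁ A x = ∀ y → y ◁ x → ¬ A y

  box[_] : Rel X ℓ → Pred X ℓ → Pred X ℓ
  box[ R ] A x = ∀ y → R x y → A y

  dia[_] : Rel X ℓ → Pred X ℓ → Pred X ℓ
  dia[ Q ] A x = ∀ x′ → x′ ◁ x → ∃[ y′ ] (Q x′ y′ × ∃[ y ] (y′ ◁ y × A y))

module Canonical {ℓ} (L : CompleteLattice ℓ) (neg box dia : CompleteLattice.Carrier L → CompleteLattice.Carrier L) where
  open CompleteLattice L

  X : Set ℓ
  X = Σ (Carrier × Carrier) (λ p → neg (proj₁ p) ≤ proj₂ p)

  _₀ : X → Carrier
  x ₀ = proj₁ (proj₁ x)

  _₁ : X → Carrier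
  x ₁ = proj₂ (proj₁ x)

  _◁_ : Rel X ℓ
  x ◁ y = ¬ ((y ₀) ≤ (x ₁))

  R : Rel X ℓ
  R x y = ∀ a → ((x ₀) ≤ box a → (y ₀) ≤ a) × (dia a ≤ (x ₁) → a ≤ (y ₁))

  Q : Rel X ℓ
  Q = R

  open FrameDefs _◁_ public

  -- (L, neg, box, dia) ≅ (𝔏(X,◁), neg◁, box_R, dia_Q):
  -- a map into the fixpoints of c◁ which is an order isomorphism onto
  -- 𝔏(X,◁) (order-embedding + surjective onto fixpoints) and commutes
  -- with the three operations.
  record IsIsomorphism (f : Carrier → Pred X ℓ) : Set (suc ℓ) where
    field
      into       : ∀ a → IsFixpoint (f a)
      monotone   : ∀ a b → a ≤ b → f a ⊆ f b
      reflecting : ∀ a b → f a ⊆ f b → a ≤ b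
      onto       : ∀ (A : Pred X ℓ) → IsFixpoint A → ∃[ a ] (f a ≐ A)
      pres-neg   : ∀ a → f (neg a) ≐ neg◁ (f a)
      pres-box   : ∀ a → f (box a) ≐ box[ R ] (f a)
      pres-dia   : ∀ a → f (dia a) ≐ dia[ Q ] (f a)

{-# OPTIONS --safe #-}
module Submission where

-- An element a of L is represented by ⟦ a ⟧ = {x | x ₀ ≤ a}.  Since box is completely
-- multiplicative and dia completely additive, box has a lower and dia an upper adjoint;
-- applying them to the two coordinates of a point x gives the extremal R-successor of x,
-- which witnesses every existential in the frame conditions and the preservation of box
-- and dia.  The test points (𝟙 , a) and (a , neg a) lie ◁-below exactly the points outside
-- ⟦ a ⟧ and ⟦ neg a ⟧ respectively; classically, this makes each ⟦ a ⟧ closed, makes ⟦_⟧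
-- preserve neg and dia, and shows that a closed set A equals ⟦ ⋁ {x ₀ | x ∈ A} ⟧.

open import Defs
open import Level using (Level; lift)
open import Data.Product using (_×_; ∃-syntax; _,_; proj₁; proj₂)
open import Data.Sum using (_⊎_; inj₁; inj₂)
open import Function using (_∘_; id)
open import Function.Bundles using (_⇔_; mk⇔; Equivalence)
open import Relation.Nullary using (¬_)
open import Relation.Nullary.Negation using (Stable)
open import Relation.Nullary.Decidable using (decidable-stable; fromSum)
open import Relation.Binary using (Rel; Poset; IsPartialOrder)
open import Relation.Binary.Definitions using (Monotonic₁; Antitonic₁)
open import Relation.Binary.PropositionalEquality using (_≡_; refl; sym; cong; subst)
open import Relation.Unary using (Pred; _⊆_; _≐_)

open Equivalence using (to; from)

byContradiction : ∀ {ℓ} → ExcludedMiddle ℓ → {P : Set ℓ} → Stable P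
byContradiction em = decidable-stable (fromSum (em _))

c◁-inflationary : ∀ {ℓ} {X : Set ℓ} (_◁_ : Rel X ℓ) (A : Pred X ℓ) → A ⊆ FrameDefs.c◁ _◁_ A
c◁-inflationary _◁_ A {x} x∈A y y◁x = x , y◁x , x∈A

module CompleteLatticeProperties {ℓ} (L : CompleteLattice ℓ) where
  open CompleteLattice L
  open IsPartialOrder isPartialOrder public
    using (antisym) renaming (refl to ≤-refl; trans to ≤-trans)

  poset : Poset ℓ ℓ ℓ
  poset = record { isPartialOrder = isPartialOrder }

  𝟘-≤ : ∀ a → 𝟘 ≤ a
  𝟘-≤ a = ⋁-least _ a λ { _ (lift ()) }

  Pair : Carrier → Carrier → Pred Carrier ℓ
  Pair a b x = x ≡ a ⊎ x ≡ b

  _∨_ : Carrier → Carrier → Carrier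
  a ∨ b = ⋁ (Pair a b)

  ∧-greatest : ∀ {a b c} → c ≤ a → c ≤ b → c ≤ (a ∧ b)
  ∧-greatest c≤a c≤b = ⋀-greatest _ _ λ { _ (inj₁ refl) → c≤a ; _ (inj₂ refl) → c≤b }

  ∨-least : ∀ {a b c} → a ≤ c → b ≤ c → (a ∨ b) ≤ c
  ∨-least a≤c b≤c = ⋁-least _ _ λ { _ (inj₁ refl) → a≤c ; _ (inj₂ refl) → b≤c }

  ≤⇒∧≡ : ∀ {a b} → a ≤ b → a ∧ b ≡ a
  ≤⇒∧≡ a≤b = antisym (⋀-lower _ _ (inj₁ refl)) (∧-greatest ≤-refl a≤b)

  ≤⇒∨≡ : ∀ {a b} → a ≤ b → a ∨ b ≡ b
  ≤⇒∨≡ a≤b = antisym (∨-least a≤b ≤-refl) (⋁-upper _ _ (inj₂ refl))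

module OperatorProperties {ℓ} (L : CompleteLattice ℓ) where
  open CompleteLattice L
  open CompleteLatticeProperties L
  open LatticeOps L
  open import Relation.Binary.Reasoning.PartialOrder poset

  neg-antitone : ∀ {neg} → DuallySelfAdjoint neg → Antitonic₁ _≤_ _≤_ neg
  neg-antitone {neg} dsa {b} {a} a≤b = dsa a (neg b) (≤-trans a≤b (dsa (neg b) b ≤-refl))

  box-monotone : ∀ {box} → CompletelyMultiplicative box → Monotonic₁ _≤_ _≤_ box
  box-monotone {box} mult {a} {b} a≤b = begin
    box a                  ≡⟨ cong box (sym (≤⇒∧≡ a≤b)) ⟩
    box (a ∧ b)            ≡⟨ mult (Pair a b) ⟩
    ⋀ (Img box (Pair a b)) ≤⟨ ⋀-lower _ _ (b , inj₂ refl , refl) ⟩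
    box b                  ∎

  dia-monotone : ∀ {dia} → CompletelyAdditive dia → Monotonic₁ _≤_ _≤_ dia
  dia-monotone {dia} add {a} {b} a≤b = begin
    dia a                  ≤⟨ ⋁-upper _ _ (a , inj₁ refl , refl) ⟩
    ⋁ (Img dia (Pair a b)) ≡⟨ add (Pair a b) ⟨
    dia (a ∨ b)            ≡⟨ cong dia (≤⇒∨≡ a≤b) ⟩
    dia b                  ∎

  lowerAdjoint : (Carrier → Carrier) → Carrier → Carrier
  lowerAdjoint f b = ⋀ (λ c → b ≤ f c)

  upperAdjoint : (Carrier → Carrier) → Carrier → Carrier
  upperAdjoint f b = ⋁ (λ c → f c ≤ b)

  lowerAdjoint-unit : ∀ {f} → CompletelyMultiplicative f → ∀ b → b ≤ f (lowerAdjoint f b)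
  lowerAdjoint-unit {f} mult b =
    subst (b ≤_) (sym (mult _)) (⋀-greatest _ b λ { _ (_ , b≤fc , refl) → b≤fc })

  upperAdjoint-counit : ∀ {f} → CompletelyAdditive f → ∀ b → f (upperAdjoint f b) ≤ b
  upperAdjoint-counit {f} add b =
    subst (_≤ b) (sym (add _)) (⋁-least _ b λ { _ (_ , fc≤b , refl) → fc≤b })

  lowerAdjoint-galois : ∀ {f} → CompletelyMultiplicative f →
                        ∀ {b c} → lowerAdjoint f b ≤ c ⇔ b ≤ f c
  lowerAdjoint-galois {f} mult {b} = mk⇔
    (≤-trans (lowerAdjoint-unit mult b) ∘ box-monotone mult)
    (⋀-lower _ _)

  upperAdjoint-galois : ∀ {f} → CompletelyAdditive f →
                        ∀ {b c} → c ≤ upperAdjoint f b ⇔ f c ≤ b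
  upperAdjoint-galois {f} add {b} = mk⇔
    (λ c≤ → ≤-trans (dia-monotone add c≤) (upperAdjoint-counit add b))
    (⋁-upper _ _)

module CanonicalFrame {ℓ} (L : CompleteLattice ℓ)
    (neg box dia : CompleteLattice.Carrier L → CompleteLattice.Carrier L) where
  open CompleteLattice L
  open CompleteLatticeProperties L
  open OperatorProperties L
  open LatticeOps L
  open Canonical L neg box dia
  open import Relation.Binary.Reasoning.PartialOrder poset

  neg₀≤₁ : ∀ x → neg (x ₀) ≤ (x ₁)
  neg₀≤₁ = proj₂

  -- x ◁ point a unfolds to ¬ a ≤ x ₁, and point a ◁ x to ¬ x ₀ ≤ neg a.
  point : Carrier → X
  point a = (a , neg a) , ≤-refl

  ⟦_⟧ : Carrier → Pred X ℓ
  ⟦ a ⟧ x = (x ₀) ≤ a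

  firstCoordinates : Pred X ℓ → Pred Carrier ℓ
  firstCoordinates A a = ∃[ x ] (A x × (x ₀) ≡ a)

  ⟦⟧-monotone : ∀ {a b} → a ≤ b → ⟦ a ⟧ ⊆ ⟦ b ⟧
  ⟦⟧-monotone a≤b x₀≤a = ≤-trans x₀≤a a≤b

  ⟦⟧-reflecting : ∀ {a b} → ⟦ a ⟧ ⊆ ⟦ b ⟧ → a ≤ b
  ⟦⟧-reflecting {a} ⟦a⟧⊆⟦b⟧ = ⟦a⟧⊆⟦b⟧ {point a} ≤-refl

  ⟦⋁⟧⊆c◁ : ExcludedMiddle ℓ → ∀ A → ⟦ ⋁ (firstCoordinates A) ⟧ ⊆ c◁ A
  ⟦⋁⟧⊆c◁ em A {x} x₀≤⋁ y y◁x = byContradiction em λ ∄z →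
    y◁x (≤-trans x₀≤⋁ (⋁-least _ (y ₁) λ { _ (z , z∈A , refl) →
      byContradiction em λ z₀≰y₁ → ∄z (z , z₀≰y₁ , z∈A) }))

  ⟦⟧-onto : ExcludedMiddle ℓ → ∀ A → IsFixpoint A → ∃[ a ] (⟦ a ⟧ ≐ A)
  ⟦⟧-onto em A (c◁A⊆A , _) =
    ⋁ (firstCoordinates A) , (λ {x} → c◁A⊆A ∘ ⟦⋁⟧⊆c◁ em A {x}) ,
    λ {x} x∈A → ⋁-upper _ (x ₀) (x , x∈A , refl)

  point-preRefines : ∀ x → PreRefines (point (x ₀)) x
  point-preRefines x w = id

  pseudoSymmetric : DuallySelfAdjoint neg → PseudoSymmetric
  pseudoSymmetric dsa x y y◁x =
    point (x ₀) , (λ y₀≤¬x₀ → y◁x (≤-trans (dsa _ _ y₀≤¬x₀) (neg₀≤₁ y))) , point-preRefines x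

  pseudoReflexive : (∀ a → a ∧ neg a ≡ 𝟘) → PseudoReflexive
  pseudoReflexive a∧¬a≡𝟘 x (y , y◁x) = point (x ₀) , point◁x , point-preRefines x
    where
    point◁x : ¬ (x ₀) ≤ neg (x ₀)
    point◁x x₀≤¬x₀ = y◁x (begin
      (x ₀)              ≤⟨ ∧-greatest ≤-refl x₀≤¬x₀ ⟩
      (x ₀) ∧ neg (x ₀)  ≡⟨ a∧¬a≡𝟘 (x ₀) ⟩
      𝟘                  ≤⟨ 𝟘-≤ (y ₁) ⟩
      (y ₁)              ∎)

  unified : Unified R Q
  unified x y = id , id

  module WithAxioms (dsa : DuallySelfAdjoint neg) (neg𝟙≡𝟘 : neg 𝟙 ≡ 𝟘)
      (mult : CompletelyMultiplicative box) (add : CompletelyAdditive dia)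
      (dia¬≤¬box : ∀ a → dia (neg a) ≤ neg (box a)) where

    -- copoint a ◁ x unfolds to ¬ x ₀ ≤ a, that is, x ∉ ⟦ a ⟧.
    copoint : Carrier → X
    copoint a = (𝟙 , a) , subst (_≤ a) (sym neg𝟙≡𝟘) (𝟘-≤ a)

    -- R x y holds iff y ₀ ≤ lowerAdjoint box (x ₀) and upperAdjoint dia (x ₁) ≤ y ₁.
    successor : X → X
    successor x = (lowerAdjoint box (x ₀) , upperAdjoint dia (x ₁)) ,
      from (upperAdjoint-galois add) (begin
        dia (neg (lowerAdjoint box (x ₀)))  ≤⟨ dia¬≤¬box _ ⟩
        neg (box (lowerAdjoint box (x ₀)))  ≤⟨ neg-antitone dsa (lowerAdjoint-unit mult (x ₀)) ⟩
        neg (x ₀)                           ≤⟨ neg₀≤₁ x ⟩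
        (x ₁)                               ∎)

    R-successor : ∀ x → R x (successor x)
    R-successor x a = from (lowerAdjoint-galois mult) , from (upperAdjoint-galois add)

    ◁-successor : ∀ x z → ¬ (x ₀) ≤ box (z ₁) → z ◁ successor x
    ◁-successor x z x₀≰ = x₀≰ ∘ to (lowerAdjoint-galois mult)

    successor-◁ : ∀ x z → ¬ dia (z ₀) ≤ (x ₁) → successor x ◁ z
    successor-◁ x z dia≰ = dia≰ ∘ to (upperAdjoint-galois add)

    isModalFrame : IsModalFrame R Q
    isModalFrame = record { nonempty = point 𝟙 ; frame = frame }
      where
      frame : ∀ x y z → R x y → z ◁ y →
              ∃[ x′ ] (x′ ◁ x × (∀ x″ → x′ ◁ x″ → ∃[ y″ ] (R x″ y″ × z ◁ y″)))
      frame x y z xRy z◁y = copoint (box (z ₁)) , z◁y ∘ proj₁ (xRy (z ₁)) ,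
        λ x″ x″₀≰ → successor x″ , R-successor x″ , ◁-successor x″ z x″₀≰

    additive : Additive R Q
    additive x y z xRy y◁z = point (dia (z ₀)) , y◁z ∘ proj₂ (xRy (z ₀)) ,
      λ x″ dia≰ → successor x″ , R-successor x″ , successor-◁ x″ z dia≰

    negative : (∀ a → neg (dia a) ≤ box (neg a)) → Negative R Q
    negative ¬dia≤box¬ x y z xRy z◁y = point (dia (z ₀)) , point◁x ,
      λ x″ dia≰ → successor x″ , R-successor x″ , successor-◁ x″ z dia≰
      where
      point◁x : ¬ (x ₀) ≤ neg (dia (z ₀))
      point◁x x₀≤ = z◁y (begin
        (y ₀)      ≤⟨ proj₁ (xRy (neg (z ₀))) (≤-trans x₀≤ (¬dia≤box¬ (z ₀))) ⟩
        neg (z ₀)  ≤⟨ neg₀≤₁ z ⟩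
        (z ₁)      ∎)

    ⟦box⟧ : ∀ a → ⟦ box a ⟧ ≐ box[ R ] ⟦ a ⟧
    ⟦box⟧ a = (λ x₀≤□a y xRy → proj₁ (xRy a) x₀≤□a)
            , λ {x} x∈□⟦a⟧ → to (lowerAdjoint-galois mult) (x∈□⟦a⟧ (successor x) (R-successor x))

    module _ (em : ExcludedMiddle ℓ) where

      ⟦⟧-fixpoint : ∀ a → IsFixpoint ⟦ a ⟧
      ⟦⟧-fixpoint a = (λ {x} → closed x) , (λ {x} → c◁-inflationary _◁_ ⟦ a ⟧ {x})
        where
        closed : ∀ x → c◁ ⟦ a ⟧ x → ⟦ a ⟧ x
        closed x x∈c◁⟦a⟧ = byContradiction em λ x₀≰a →
          let (z , z₀≰a , z₀≤a) = x∈c◁⟦a⟧ (copoint a) x₀≰a in z₀≰a z₀≤a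

      ⟦neg⟧ : ∀ a → ⟦ neg a ⟧ ≐ neg◁ ⟦ a ⟧
      ⟦neg⟧ a = (λ {x} x₀≤¬a y y◁x y₀≤a → y◁x (begin
                  (x ₀)      ≤⟨ x₀≤¬a ⟩
                  neg a      ≤⟨ neg-antitone dsa y₀≤a ⟩
                  neg (y ₀)  ≤⟨ neg₀≤₁ y ⟩
                  (y ₁)      ∎))
              , λ x∈¬⟦a⟧ → byContradiction em λ x₀≰¬a → x∈¬⟦a⟧ (point a) x₀≰¬a ≤-refl

      ⟦dia⟧ : ∀ a → ⟦ dia a ⟧ ≐ dia[ Q ] ⟦ a ⟧
      ⟦dia⟧ a = (λ x₀≤◇a x′ x′◁x → successor x′ , R-successor x′ , point a ,
                   successor-◁ x′ (point a) (x′◁x ∘ ≤-trans x₀≤◇a) , ≤-refl)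
              , λ x∈◇⟦a⟧ → byContradiction em λ x₀≰◇a →
                  let (y′ , Ry′ , y , y′◁y , y₀≤a) = x∈◇⟦a⟧ (copoint (dia a)) x₀≰◇a
                  in y′◁y (≤-trans y₀≤a (proj₂ (Ry′ a) ≤-refl))

      isIsomorphism : IsIsomorphism ⟦_⟧
      isIsomorphism = record
        { into       = ⟦⟧-fixpoint
        ; monotone   = λ _ _ → ⟦⟧-monotone
        ; reflecting = λ _ _ → ⟦⟧-reflecting
        ; onto       = ⟦⟧-onto em
        ; pres-neg   = ⟦neg⟧
        ; pres-box   = ⟦box⟧
        ; pres-dia   = ⟦dia⟧
        }

theorem5p2 : ∀ {ℓ : Level} (L : CompleteLattice ℓ)
    (neg box dia : CompleteLattice.Carrier L → CompleteLattice.Carrier L) →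
    ExcludedMiddle ℓ →
    LatticeOps.DuallySelfAdjoint L neg →
    neg (CompleteLattice.𝟙 L) ≡ CompleteLattice.𝟘 L →
    LatticeOps.CompletelyMultiplicative L box →
    LatticeOps.CompletelyAdditive L dia →
    (∀ a → CompleteLattice._≤_ L (dia (neg a)) (neg (box a))) →
    let open Canonical L neg box dia in
      (IsModalFrame R Q × Unified R Q × Additive R Q × PseudoSymmetric)
      × (∃[ f ] IsIsomorphism f)
      × ((∀ a → CompleteLattice._∧_ L a (neg a) ≡ CompleteLattice.𝟘 L) → PseudoReflexive)
      × ((∀ a → CompleteLattice._≤_ L (neg (dia a)) (box (neg a))) → Negative R Q)
theorem5p2 L neg box dia em dsa neg𝟙≡𝟘 mult add dia¬≤¬box =
    (isModalFrame , unified , additive , pseudoSymmetric dsa)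
  , (⟦_⟧ , isIsomorphism em)
  , pseudoReflexive
  , negative
  where
  open CanonicalFrame L neg box dia
  open WithAxioms dsa neg𝟙≡𝟘 mult add dia¬≤¬box
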